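{- Let $n\ge 6$ and $i\in[n-1]$. Then \[\max\{d_\ell(\sigma,\rho):\sigma,\rho\in\mathcal{D}(\{i\};n),\ \sigma\ne\rho\}=\begin{cases} n-2 & \text{for } i=1 \text{ or } i=n-1,\\ n-i & \text{for } i=2,3,\ldots,\lfloor n/2\rfloor,\\ i & \text{for } i=\lceil n/2\rceil,\lceil n/2\rceil+1,\ldots,n-2.\end{cases}\]
   Context: $S_n$ is the symmetric group on $[n]=\{1,\ldots,n\}$, with permutations in one-line notation $\sigma=\sigma_1\cdots\sigma_n$. The descent set of $\sigma$ is $\mathcal{D}(\sigma)=\{j\in[n-1]:\sigma_j>\sigma_{j+1}\}$, and for $S\subseteq[n-1]$, $\mathcal{D}(S;n)=\{\sigma\in S_n:\mathcal{D}(\sigma)=S\}$. The $\ell_\infty$-metric is $d_\ell(\sigma,\rho)=\max\{|\sigma_j-\rho_j|:1\le j\le n\}$. -}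

module Defs where

open import Data.Nat using (ℕ; zero; suc; _<_; _≤_; _⊔_; ∣_-_∣)
open import Data.Fin using (Fin; toℕ)
open import Data.Fin.Permutation using (Permutation′; _⟨$⟩ʳ_; _≈_)
open import Data.List using (foldr; map; allFin)
open import Data.Product using (Σ; _×_)
open import Relation.Binary.PropositionalEquality using (_≡_)
open import Relation.Nullary using (¬_)
open import Function.Bundles using (_⇔_)

-- One-line notation: the value of σ at position (toℕ k + 1) is toℕ (σ ⟨$⟩ʳ k) + 1.
-- (Positions and values are shifted by one; this does not affect comparisons or differences.)
val : ∀ {n} → Permutation′ n → Fin n → ℕ
val σ k = toℕ (σ ⟨$⟩ʳ k)

DescentSetSingleton : (n i : ℕ) → Permutation′ n → Set
DescentSetSingleton n i σ =
  (k l : Fin n) → toℕ l ≡ suc (toℕ k) → (val σ l < val σ k) ⇔ (suc (toℕ k) ≡ i)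

dℓ : ∀ {n} → Permutation′ n → Permutation′ n → ℕ
dℓ {n} σ ρ = foldr _⊔_ 0 (map (λ k → ∣ val σ k - val ρ k ∣) (allFin n))

IsMaxDist : (n i M : ℕ) → Set
IsMaxDist n i M =
  Σ (Permutation′ n) (λ σ → Σ (Permutation′ n) (λ ρ →
      DescentSetSingleton n i σ × DescentSetSingleton n i ρ × ¬ (σ ≈ ρ) × dℓ σ ρ ≡ M))
  × ((σ ρ : Permutation′ n) → DescentSetSingleton n i σ → DescentSetSingleton n i ρ →
      ¬ (σ ≈ ρ) → dℓ σ ρ ≤ M)

{-# OPTIONS --safe #-}
module Submission where

-- A permutation with single descent i increases on the positions 1 … i and on i+1 … n.
-- Ascending runs confine every entry to a window that depends only on its position:
-- σ_x ∈ [x, x + (n - i)] for x ≤ i, σ_x ∈ [x - i, x] for x > i, and the two entries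
-- σ_i > σ_(i+1) at the descent lie in windows of width n - 2.  So two such permutations
-- differ by at most the window width at every position.  The bound is attained by the
-- rotation (n-i+1 … n 1 … n-i) against the identity with entries i and i+1 exchanged,
-- compared at the first position when i ≤ n/2 and at the last one when i ≥ n/2.

open import Data.Empty using (⊥-elim)
open import Data.Fin using (Fin; toℕ; fromℕ<)
open import Data.Fin.Permutation using (Permutation′; permutation; _⟨$⟩ʳ_; _⟨$⟩ˡ_; inverseˡ; _≈_)
open import Data.Fin.Properties using (toℕ<n; toℕ-fromℕ<; fromℕ<-toℕ; toℕ-injective)
open import Data.List.Properties using (foldr-preservesᵇ; foldr-preservesᵒ)
import Data.List.Relation.Unary.All.Properties as All
import Data.List.Relation.Unary.Any.Properties as Any
open import Data.Nat
  using (ℕ; zero; suc; _+_; _∸_; _≤_; _<_; _⊔_; ∣_-_∣; z≤n; s≤s; z<s; s≤s⁻¹; _<?_; _≟_; ⌊_/2⌋; ⌈_/2⌉)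
open import Data.Nat.Properties
open import Algebra.Properties.CommutativeSemigroup +-commutativeSemigroup using (x∙yz≈y∙xz)
open import Data.Product using (_×_; _,_)
open import Data.Sum using (_⊎_; inj₁; inj₂; [_,_])
open import Defs
open import Function using (_∘_)
open import Function.Bundles using (_⇔_; mk⇔; Equivalence)
open import Relation.Binary.Definitions using (tri<; tri≈; tri>)
open import Relation.Binary.PropositionalEquality
  using (_≡_; _≢_; refl; sym; trans; cong; cong₂; subst; subst₂; module ≡-Reasoning)
open import Relation.Nullary using (¬_; yes; no; contradiction)
open import Relation.Nullary.Decidable using (decidable-stable)

InWindow : ℕ → ℕ → ℕ → Set
InWindow lo w a = lo ≤ a × a ≤ lo + w

∣-∣≤width : ∀ {lo w a b} → InWindow lo w a → InWindow lo w b → ∣ a - b ∣ ≤ w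
∣-∣≤width {lo} {w} {a} {b} (lo≤a , a≤) (lo≤b , b≤) = begin
  ∣ a - b ∣                          ≡⟨ cong₂ ∣_-_∣ (m+[n∸m]≡n lo≤a) (m+[n∸m]≡n lo≤b) ⟨
  ∣ lo + (a ∸ lo) - lo + (b ∸ lo) ∣  ≡⟨ ∣m+n-m+o∣≡∣n-o∣ lo _ _ ⟩
  ∣ a ∸ lo - b ∸ lo ∣                ≤⟨ ∣m-n∣≤m⊔n (a ∸ lo) (b ∸ lo) ⟩
  (a ∸ lo) ⊔ (b ∸ lo)                ≤⟨ ⊔-lub (m≤n+o⇒m∸n≤o a lo a≤) (m≤n+o⇒m∸n≤o b lo b≤) ⟩
  w                                  ∎
  where open ≤-Reasoning

ascending-run : ∀ (f : ℕ → ℕ) x d → (∀ {e} → e < d → f (x + e) < f (suc (x + e))) →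
                f x + d ≤ f (x + d)
ascending-run f x zero    _    =
  ≤-reflexive (trans (+-identityʳ (f x)) (cong f (sym (+-identityʳ x))))
ascending-run f x (suc d) step = begin
  f x + suc d      ≡⟨ +-suc (f x) d ⟩
  suc (f x + d)    ≤⟨ s≤s (ascending-run f x d (step ∘ m<n⇒m<1+n)) ⟩
  suc (f (x + d))  ≤⟨ step (n<1+n d) ⟩
  f (suc (x + d))  ≡⟨ cong f (+-suc x d) ⟨
  f (x + suc d)    ∎
  where open ≤-Reasoning

m<n⇒m≤1+[n∸2] : ∀ {m n} → m < n → m ≤ suc (n ∸ 2)
m<n⇒m≤1+[n∸2] {n = suc zero}    (s≤s m≤0) = m≤n⇒m≤1+n m≤0
m<n⇒m≤1+[n∸2] {n = suc (suc n)} (s≤s m≤n) = m≤n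

2+m≤n⇒m≤n∸2 : ∀ {m n} → 2 + m ≤ n → m ≤ n ∸ 2
2+m≤n⇒m≤n∸2 (s≤s (s≤s m≤n)) = m≤n

m≤⌊n/2⌋⇒m+m≤n : ∀ {m n} → m ≤ ⌊ n /2⌋ → m + m ≤ n
m≤⌊n/2⌋⇒m+m≤n {m} {n} m≤⌊n/2⌋ = begin
  m + m                  ≤⟨ +-mono-≤ m≤⌊n/2⌋ (≤-trans m≤⌊n/2⌋ (⌊n/2⌋≤⌈n/2⌉ n)) ⟩
  ⌊ n /2⌋ + ⌈ n /2⌉      ≡⟨ ⌊n/2⌋+⌈n/2⌉≡n n ⟩
  n                      ∎
  where open ≤-Reasoning

⌈n/2⌉≤m⇒n≤m+m : ∀ {m n} → ⌈ n /2⌉ ≤ m → n ≤ m + m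
⌈n/2⌉≤m⇒n≤m+m {m} {n} ⌈n/2⌉≤m = begin
  n                      ≡⟨ ⌊n/2⌋+⌈n/2⌉≡n n ⟨
  ⌊ n /2⌋ + ⌈ n /2⌉      ≤⟨ +-mono-≤ (≤-trans (⌊n/2⌋≤⌈n/2⌉ n) ⌈n/2⌉≤m) ⌈n/2⌉≤m ⟩
  m + m                  ∎
  where open ≤-Reasoning

record SingleDescentSeq (n i : ℕ) (f : ℕ → ℕ) : Set where
  field
    bounded : ∀ {x} → x < n → f x < n
    ascent  : ∀ {x} → suc x < n → suc x ≢ i → f x < f (suc x)
    descent : ∀ {x} → suc x < n → suc x ≡ i → f (suc x) < f x

module Windows {n i f} (i<n : i < n) (s : SingleDescentSeq n i f) where
  open SingleDescentSeq s

  private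
    ascending : ∀ x d → x + d < n → (∀ {e} → e < d → suc (x + e) ≢ i) → f x + d ≤ f (x + d)
    ascending x d x+d<n no-descent =
      ascending-run f x d (λ e<d → ascent (≤-<-trans (+-monoʳ-< x e<d) x+d<n) (no-descent e<d))

    room-above : ∀ x d → x + d < n → (∀ {e} → e < d → suc (x + e) ≢ i) → f x + d < n
    room-above x d x+d<n no-descent = ≤-<-trans (ascending x d x+d<n no-descent) (bounded x+d<n)

    room-below : ∀ x d → x + d < n → (∀ {e} → e < d → suc (x + e) ≢ i) → d ≤ f (x + d)
    room-below x d x+d<n no-descent = ≤-trans (m≤n+m d (f x)) (ascending x d x+d<n no-descent)

  window-before : ∀ {x} → x < i → InWindow x (n ∸ i) (f x)
  window-before {x} x<i =
    room-below 0 x (<-trans x<i i<n) (λ e<x → <⇒≢ (≤-<-trans e<x x<i)) , upper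
    where
    d = i ∸ suc x
    x+d<i : x + d < i
    x+d<i = ≤-reflexive (m+[n∸m]≡n x<i)
    fx+d<n : f x + d < n
    fx+d<n = room-above x d (<-trans x+d<i i<n)
      (λ e<d → <⇒≢ (<-≤-trans (s≤s (+-monoʳ-< x e<d)) x+d<i))
    upper : f x ≤ x + (n ∸ i)
    upper = begin
      f x                        ≤⟨ m+n≤o⇒m≤o∸n (f x) fx+i≤x+n ⟩
      x + n ∸ i                  ≡⟨ +-∸-assoc x (<⇒≤ i<n) ⟩
      x + (n ∸ i)                ∎
      where
      open ≤-Reasoning
      fx+i≤x+n : f x + i ≤ x + n
      fx+i≤x+n = begin
        f x + i                  ≡⟨ cong (f x +_) (m+[n∸m]≡n x<i) ⟨
        f x + suc (x + d)        ≡⟨ +-suc (f x) (x + d) ⟩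
        suc (f x + (x + d))      ≡⟨ cong suc (x∙yz≈y∙xz (f x) x d) ⟩
        suc (x + (f x + d))      ≡⟨ +-suc x (f x + d) ⟨
        x + suc (f x + d)        ≤⟨ +-monoʳ-≤ x fx+d<n ⟩
        x + n                    ∎

  window-after : ∀ {x} → i ≤ x → x < n → InWindow (x ∸ i) i (f x)
  window-after {x} i≤x x<n = lower , subst (f x ≤_) (sym (m∸n+n≡m i≤x)) upper
    where
    i+[x∸i]≡x : i + (x ∸ i) ≡ x
    i+[x∸i]≡x = m+[n∸m]≡n i≤x
    lower : x ∸ i ≤ f x
    lower = subst (λ y → x ∸ i ≤ f y) i+[x∸i]≡x
      (room-below i (x ∸ i) (subst (_< n) (sym i+[x∸i]≡x) x<n) (λ _ → >⇒≢ (s≤s (m≤m+n i _))))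
    d = n ∸ suc x
    x+d+1≡n : suc (x + d) ≡ n
    x+d+1≡n = m+[n∸m]≡n x<n
    upper : f x ≤ x
    upper = +-cancelʳ-≤ d (f x) x (s≤s⁻¹ (≤-trans
      (room-above x d (≤-reflexive x+d+1≡n) (λ _ → >⇒≢ (s≤s (≤-trans i≤x (m≤m+n x _)))))
      (≤-reflexive (sym x+d+1≡n))))

  window-peak : ∀ {x} → suc x ≡ i → InWindow 1 (n ∸ 2) (f x)
  window-peak {x} refl =
    ≤-trans (s≤s z≤n) (descent i<n refl) , m<n⇒m≤1+[n∸2] (bounded (<-trans (n<1+n x) i<n))

  window-valley : ∀ {x} → suc x ≡ i → InWindow 0 (n ∸ 2) (f (suc x))
  window-valley {x} refl =
    z≤n , 2+m≤n⇒m≤n∸2 (≤-trans (s≤s (descent i<n refl)) (bounded (<-trans (n<1+n x) i<n)))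

open Windows

DistanceBound : ℕ → ℕ → ℕ → Set
DistanceBound n i M = ∀ {f g} → SingleDescentSeq n i f → SingleDescentSeq n i g →
                      ∀ {x} → x < n → ∣ f x - g x ∣ ≤ M

distanceBound-⊔ : ∀ {n i} → i < n → DistanceBound n i ((n ∸ i) ⊔ i)
distanceBound-⊔ {n} {i} i<n s t {x} x<n with x <? i
... | yes x<i = ≤-trans (∣-∣≤width (window-before i<n s x<i) (window-before i<n t x<i))
                        (m≤m⊔n (n ∸ i) i)
... | no  x≮i = ≤-trans (∣-∣≤width (window-after i<n s i≤x x<n) (window-after i<n t i≤x x<n))
                        (m≤n⊔m (n ∸ i) i)
  where i≤x = ≮⇒≥ x≮i

-- Positions x ≥ n read the junk value 0; every lemma below only looks at x < n.
valℕ : ∀ {n} → Permutation′ n → ℕ → ℕ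
valℕ {n} σ x with x <? n
... | yes x<n = val σ (fromℕ< x<n)
... | no  _   = 0

valℕ-fromℕ< : ∀ {n} (σ : Permutation′ n) {x} (x<n : x < n) → valℕ σ x ≡ val σ (fromℕ< x<n)
valℕ-fromℕ< {n} σ {x} x<n with x <? n
... | yes _   = refl
... | no  x≮n = contradiction x<n x≮n

valℕ-toℕ : ∀ {n} (σ : Permutation′ n) k → valℕ σ (toℕ k) ≡ val σ k
valℕ-toℕ σ k = trans (valℕ-fromℕ< σ (toℕ<n k)) (cong (val σ) (fromℕ<-toℕ k (toℕ<n k)))

val-injective : ∀ {n} (σ : Permutation′ n) {k l} → val σ k ≡ val σ l → k ≡ l
val-injective σ {k} {l} eq = begin
  k                    ≡⟨ inverseˡ σ ⟨
  σ ⟨$⟩ˡ (σ ⟨$⟩ʳ k)    ≡⟨ cong (σ ⟨$⟩ˡ_) (toℕ-injective eq) ⟩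
  σ ⟨$⟩ˡ (σ ⟨$⟩ʳ l)    ≡⟨ inverseˡ σ ⟩
  l                    ∎
  where open ≡-Reasoning

valℕ-injective : ∀ {n} (σ : Permutation′ n) {x y} (x<n : x < n) (y<n : y < n) →
                 valℕ σ x ≡ valℕ σ y → x ≡ y
valℕ-injective σ {x} {y} x<n y<n eq = begin
  x                     ≡⟨ toℕ-fromℕ< x<n ⟨
  toℕ (fromℕ< x<n)      ≡⟨ cong toℕ (val-injective σ
                             (trans (sym (valℕ-fromℕ< σ x<n)) (trans eq (valℕ-fromℕ< σ y<n)))) ⟩
  toℕ (fromℕ< y<n)      ≡⟨ toℕ-fromℕ< y<n ⟩
  y                     ∎
  where open ≡-Reasoning

singleDescentSeq-valℕ : ∀ {n i} (σ : Permutation′ n) → DescentSetSingleton n i σ →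
                        SingleDescentSeq n i (valℕ σ)
singleDescentSeq-valℕ {n} {i} σ D = record
  { bounded = λ x<n → subst (_< n) (sym (valℕ-fromℕ< σ x<n)) (toℕ<n _)
  ; ascent  = ascent
  ; descent = λ sx<n → Equivalence.from (descent⇔ sx<n)
  }
  where
  descent⇔ : ∀ {x} → suc x < n → (valℕ σ (suc x) < valℕ σ x) ⇔ (suc x ≡ i)
  descent⇔ {x} sx<n =
    subst₂ (λ a b → (a < b) ⇔ (suc x ≡ i)) (sym (valℕ-fromℕ< σ sx<n)) (sym (valℕ-fromℕ< σ x<n))
      descent-at-k
    where
    x<n = <-trans (n<1+n x) sx<n
    k = fromℕ< x<n
    l = fromℕ< sx<n
    descent-at-k : (val σ l < val σ k) ⇔ (suc x ≡ i)
    descent-at-k = subst (λ y → (val σ l < val σ k) ⇔ (suc y ≡ i)) (toℕ-fromℕ< x<n)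
      (D k l (trans (toℕ-fromℕ< sx<n) (cong suc (sym (toℕ-fromℕ< x<n)))))
  ascent : ∀ {x} → suc x < n → suc x ≢ i → valℕ σ x < valℕ σ (suc x)
  ascent {x} sx<n sx≢i = ≤∧≢⇒<
    (≮⇒≥ (sx≢i ∘ Equivalence.to (descent⇔ sx<n)))
    (1+n≢n ∘ sym ∘ valℕ-injective σ (<-trans (n<1+n x) sx<n) sx<n)

dℓ-≤ : ∀ {n M} (σ ρ : Permutation′ n) → (∀ k → ∣ val σ k - val ρ k ∣ ≤ M) → dℓ σ ρ ≤ M
dℓ-≤ {M = M} σ ρ bound = foldr-preservesᵇ {P = _≤ M} ⊔-lub z≤n (All.map⁺ (All.tabulate⁺ bound))

∣-∣≤dℓ : ∀ {n} (σ ρ : Permutation′ n) k → ∣ val σ k - val ρ k ∣ ≤ dℓ σ ρ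
∣-∣≤dℓ σ ρ k = foldr-preservesᵒ {P = ∣ val σ k - val ρ k ∣ ≤_}
  (λ x y → [ m≤n⇒m≤n⊔o y , m≤n⇒m≤o⊔n x ]) 0 _ (inj₂ (Any.map⁺ (Any.tabulate⁺ k ≤-refl)))

dℓ-≤-distanceBound : ∀ {n i M} → DistanceBound n i M → (σ ρ : Permutation′ n) →
                     DescentSetSingleton n i σ → DescentSetSingleton n i ρ → dℓ σ ρ ≤ M
dℓ-≤-distanceBound {M = M} bound σ ρ Dσ Dρ = dℓ-≤ σ ρ λ k →
  subst (_≤ M) (cong₂ ∣_-_∣ (valℕ-toℕ σ k) (valℕ-toℕ ρ k))
    (bound (singleDescentSeq-valℕ σ Dσ) (singleDescentSeq-valℕ ρ Dρ) (toℕ<n k))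

isMaxDist-intro : ∀ {n i M} → DistanceBound n i M → (σ ρ : Permutation′ n) →
                  DescentSetSingleton n i σ → DescentSetSingleton n i ρ →
                  (k : Fin n) → ∣ val σ k - val ρ k ∣ ≡ M → 0 < M → IsMaxDist n i M
isMaxDist-intro bound σ ρ Dσ Dρ k attained 0<M =
  (σ , ρ , Dσ , Dρ , σ≉ρ , ≤-antisym (dℓ-≤-distanceBound bound σ ρ Dσ Dρ) M≤dℓ) ,
  λ σ′ ρ′ Dσ′ Dρ′ _ → dℓ-≤-distanceBound bound σ′ ρ′ Dσ′ Dρ′
  where
  M≤dℓ = subst (_≤ dℓ σ ρ) attained (∣-∣≤dℓ σ ρ k)
  σ≉ρ : ¬ σ ≈ ρ
  σ≉ρ σ≈ρ = <⇒≢ 0<M (trans (sym (m≡n⇒∣m-n∣≡0 (cong toℕ (σ≈ρ k)))) attained)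

descent⇔-intro : ∀ {p q s i : ℕ} → (s ≡ i → q < p) → (s ≢ i → p ≤ q) → (q < p) ⇔ (s ≡ i)
descent⇔-intro {s = s} {i} at-i elsewhere =
  mk⇔ (λ q<p → decidable-stable (s ≟ i) (λ s≢i → <⇒≱ q<p (elsewhere s≢i))) at-i

record PermutationBelow (n : ℕ) : Set where
  field
    to from : ℕ → ℕ
    to-<    : ∀ {x} → x < n → to x < n
    from-<  : ∀ {x} → x < n → from x < n
    from-to : ∀ {x} → x < n → from (to x) ≡ x
    to-from : ∀ {x} → x < n → to (from x) ≡ x

  private
    restrict : (h : ℕ → ℕ) → (∀ {x} → x < n → h x < n) → Fin n → Fin n
    restrict h h-< k = fromℕ< (h-< (toℕ<n k))

    restrict-inverse : ∀ {g h} (g-< : ∀ {x} → x < n → g x < n) (h-< : ∀ {x} → x < n → h x < n) →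
                       (∀ {x} → x < n → g (h x) ≡ x) →
                       ∀ k → restrict g g-< (restrict h h-< k) ≡ k
    restrict-inverse {g} {h} g-< h-< g∘h≡id k = toℕ-injective (begin
      toℕ (restrict g g-< (restrict h h-< k))  ≡⟨ toℕ-fromℕ< _ ⟩
      g (toℕ (restrict h h-< k))               ≡⟨ cong g (toℕ-fromℕ< _) ⟩
      g (h (toℕ k))                            ≡⟨ g∘h≡id (toℕ<n k) ⟩
      toℕ k                                    ∎)
      where open ≡-Reasoning

  toPermutation : Permutation′ n
  toPermutation = permutation (restrict to to-<) (restrict from from-<)
    (restrict-inverse to-< from-< to-from) (restrict-inverse from-< to-< from-to)

  val-toPermutation : ∀ k → val toPermutation k ≡ to (toℕ k)
  val-toPermutation k = toℕ-fromℕ< _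

  descentSet-toPermutation : ∀ {i} → (∀ x → (to (suc x) < to x) ⇔ (suc x ≡ i)) →
                             DescentSetSingleton n i toPermutation
  descentSet-toPermutation descents k l l≡k+1
    rewrite val-toPermutation k | val-toPermutation l | l≡k+1 = descents (toℕ k)

open PermutationBelow

rotation : ℕ → ℕ → ℕ → ℕ
rotation a b x with x <? a
... | yes _ = x + b
... | no  _ = x ∸ a

rotation-< : ∀ a b {x} → x < a → rotation a b x ≡ x + b
rotation-< a b {x} x<a with x <? a
... | yes _   = refl
... | no  x≮a = contradiction x<a x≮a

rotation-≥ : ∀ a b {x} → a ≤ x → rotation a b x ≡ x ∸ a
rotation-≥ a b {x} a≤x with x <? a
... | yes x<a = contradiction a≤x (<⇒≱ x<a)
... | no  _   = refl

rotation-bounded : ∀ a b {x} → x < a + b → rotation a b x < a + b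
rotation-bounded a b {x} x<a+b with x <? a
... | yes x<a = +-monoˡ-< b x<a
... | no  _   = ≤-<-trans (m∸n≤m x a) x<a+b

rotation-inverse : ∀ a b {x} → x < a + b → rotation b a (rotation a b x) ≡ x
rotation-inverse a b {x} x<a+b with x <? a
... | yes _   = trans (rotation-≥ b a (m≤n+m b x)) (m+n∸n≡m x b)
... | no  x≮a = trans (rotation-< b a x∸a<b) (m∸n+n≡m a≤x)
  where
  a≤x = ≮⇒≥ x≮a
  x∸a<b : x ∸ a < b
  x∸a<b = +-cancelˡ-< a (x ∸ a) b (subst (_< a + b) (sym (m+[n∸m]≡n a≤x)) x<a+b)

rotation-descents : ∀ a b → 0 < b → ∀ x → (rotation a b (suc x) < rotation a b x) ⇔ (suc x ≡ a)
rotation-descents a b 0<b x with <-cmp (suc x) a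
... | tri< sx<a sx≢a _ = descent⇔-intro (⊥-elim ∘ sx≢a)
  λ _ → subst₂ _≤_ (sym (rotation-< a b (<-trans (n<1+n x) sx<a))) (sym (rotation-< a b sx<a))
                   (n≤1+n (x + b))
... | tri≈ _ refl _ = descent⇔-intro
  (λ _ → subst₂ _<_ (sym (trans (rotation-≥ (suc x) b ≤-refl) (n∸n≡0 (suc x))))
                    (sym (rotation-< (suc x) b ≤-refl)) (≤-trans 0<b (m≤n+m b x)))
  (λ sx≢sx → contradiction refl sx≢sx)
... | tri> _ sx≢a a<sx = descent⇔-intro (⊥-elim ∘ sx≢a)
  λ _ → subst₂ _≤_ (sym (rotation-≥ a b (s≤s⁻¹ a<sx))) (sym (rotation-≥ a b (<⇒≤ a<sx)))
                   (∸-monoˡ-≤ a (n≤1+n x))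

adjacentSwap : ℕ → ℕ → ℕ
adjacentSwap a x with x ≟ a | x ≟ suc a
... | yes _ | _     = suc a
... | no  _ | yes _ = a
... | no  _ | no  _ = x

adjacentSwap-left : ∀ a → adjacentSwap a a ≡ suc a
adjacentSwap-left a with a ≟ a
... | yes _   = refl
... | no  a≢a = contradiction refl a≢a

adjacentSwap-right : ∀ a → adjacentSwap a (suc a) ≡ a
adjacentSwap-right a with suc a ≟ a | suc a ≟ suc a
... | yes 1+a≡a | _     = contradiction 1+a≡a 1+n≢n
... | no  _     | yes _ = refl
... | no  _     | no  ≢ = contradiction refl ≢

adjacentSwap-other : ∀ a {x} → x ≢ a → x ≢ suc a → adjacentSwap a x ≡ x
adjacentSwap-other a {x} x≢a x≢1+a with x ≟ a | x ≟ suc a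
... | yes x≡a | _         = contradiction x≡a x≢a
... | no  _   | yes x≡1+a = contradiction x≡1+a x≢1+a
... | no  _   | no  _     = refl

adjacentSwap-involutive : ∀ a x → adjacentSwap a (adjacentSwap a x) ≡ x
adjacentSwap-involutive a x with x ≟ a | x ≟ suc a
... | yes refl | _        = adjacentSwap-right x
... | no  _    | yes refl = adjacentSwap-left a
... | no  x≢a  | no x≢1+a = adjacentSwap-other a x≢a x≢1+a

adjacentSwap-bounded : ∀ {n} a {x} → suc a < n → x < n → adjacentSwap a x < n
adjacentSwap-bounded a {x} 1+a<n x<n with x ≟ a | x ≟ suc a
... | yes _ | _     = 1+a<n
... | no  _ | yes _ = <-trans (n<1+n a) 1+a<n
... | no  _ | no  _ = x<n

adjacentSwap-≤-suc : ∀ a x → adjacentSwap a x ≤ suc x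
adjacentSwap-≤-suc a x with x ≟ a | x ≟ suc a
... | yes refl | _        = ≤-refl
... | no  _    | yes refl = m≤n⇒m≤1+n (n≤1+n a)
... | no  _    | no  _    = n≤1+n x

adjacentSwap-≥ : ∀ a {x} → x ≢ suc a → x ≤ adjacentSwap a x
adjacentSwap-≥ a {x} x≢1+a with x ≟ a | x ≟ suc a
... | yes refl | _         = n≤1+n x
... | no  _    | yes x≡1+a = contradiction x≡1+a x≢1+a
... | no  _    | no  _     = ≤-refl

adjacentSwap-descents : ∀ a x → (adjacentSwap a (suc x) < adjacentSwap a x) ⇔ (suc x ≡ suc a)
adjacentSwap-descents a x = descent⇔-intro
  (λ { refl → subst₂ _<_ (sym (adjacentSwap-right x)) (sym (adjacentSwap-left x)) ≤-refl })
  (λ sx≢sa → ≤-trans (adjacentSwap-≤-suc a x) (adjacentSwap-≥ a sx≢sa))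

rotationBelow : ∀ {n} a b → a + b ≡ n → PermutationBelow n
rotationBelow a b _    .to      = rotation a b
rotationBelow a b _    .from    = rotation b a
rotationBelow a b refl .to-<    = rotation-bounded a b
rotationBelow a b refl .from-<  {x} x<a+b =
  subst (rotation b a x <_) (+-comm b a) (rotation-bounded b a (subst (x <_) (+-comm a b) x<a+b))
rotationBelow a b refl .from-to = rotation-inverse a b
rotationBelow a b refl .to-from {x} x<a+b = rotation-inverse b a (subst (x <_) (+-comm a b) x<a+b)

adjacentSwapBelow : ∀ {n} a → suc a < n → PermutationBelow n
adjacentSwapBelow a _     .to      = adjacentSwap a
adjacentSwapBelow a _     .from    = adjacentSwap a
adjacentSwapBelow a 1+a<n .to-<    = adjacentSwap-bounded a 1+a<n
adjacentSwapBelow a 1+a<n .from-<  = adjacentSwap-bounded a 1+a<n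
adjacentSwapBelow a _     .from-to {x} _ = adjacentSwap-involutive a x
adjacentSwapBelow a _     .to-from {x} _ = adjacentSwap-involutive a x

module Witnesses {n} (a : ℕ) (1+a<n : suc a < n) where
  rotated swapped : PermutationBelow n
  rotated = rotationBelow (suc a) (n ∸ suc a) (m+[n∸m]≡n (<⇒≤ 1+a<n))
  swapped = adjacentSwapBelow a 1+a<n

  isMaxDist-witnessed : ∀ {M} → DistanceBound n (suc a) M → ∀ {x} (x<n : x < n) →
                        ∣ rotation (suc a) (n ∸ suc a) x - adjacentSwap a x ∣ ≡ M → 0 < M →
                        IsMaxDist n (suc a) M
  isMaxDist-witnessed bound {x} x<n attained =
    isMaxDist-intro bound (toPermutation rotated) (toPermutation swapped)
      (descentSet-toPermutation rotated (rotation-descents (suc a) (n ∸ suc a) (m<n⇒0<n∸m 1+a<n)))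
      (descentSet-toPermutation swapped (adjacentSwap-descents a))
      (fromℕ< x<n)
      (begin
        ∣ val (toPermutation rotated) k - val (toPermutation swapped) k ∣
          ≡⟨ cong₂ ∣_-_∣ (val-toPermutation rotated k) (val-toPermutation swapped k) ⟩
        ∣ rotation (suc a) (n ∸ suc a) (toℕ k) - adjacentSwap a (toℕ k) ∣
          ≡⟨ cong (λ y → ∣ rotation (suc a) (n ∸ suc a) y - adjacentSwap a y ∣) (toℕ-fromℕ< x<n) ⟩
        ∣ rotation (suc a) (n ∸ suc a) x - adjacentSwap a x ∣
          ≡⟨ attained ⟩
        _ ∎)
    where
    k = fromℕ< x<n
    open ≡-Reasoning

isMaxDist-first : ∀ {n} → 3 ≤ n → IsMaxDist n 1 (n ∸ 2)
isMaxDist-first (s≤s (s≤s (s≤s {n = m} _))) = isMaxDist-witnessed bound z<s refl z<s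
  where
  1<n : 1 < suc (suc (suc m))
  1<n = s≤s (s≤s z≤n)
  open Witnesses 0 1<n
  bound : DistanceBound (suc (suc (suc m))) 1 (suc m)
  bound s t {zero}  _   = ∣-∣≤width (window-peak 1<n s refl) (window-peak 1<n t refl)
  bound s t {suc x} x<n = ≤-trans
    (∣-∣≤width (window-after 1<n s (s≤s z≤n) x<n) (window-after 1<n t (s≤s z≤n) x<n)) (s≤s z≤n)

isMaxDist-last : ∀ {n} → 3 ≤ n → IsMaxDist n (n ∸ 1) (n ∸ 2)
isMaxDist-last (s≤s (s≤s (s≤s {n = m} _))) = isMaxDist-witnessed bound ≤-refl attained z<s
  where
  i = suc (suc m)
  i<n : i < suc i
  i<n = ≤-refl
  open Witnesses (suc m) i<n
  attained : ∣ rotation i (suc i ∸ i) i - adjacentSwap (suc m) i ∣ ≡ suc m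
  attained = cong₂ ∣_-_∣ (trans (rotation-≥ i (suc i ∸ i) ≤-refl) (n∸n≡0 i)) (adjacentSwap-right (suc m))
  bound : DistanceBound (suc i) i (suc m)
  bound s t {x} x<n with m<1+n⇒m<n∨m≡n x<n
  ... | inj₁ x<i  = ≤-trans
    (∣-∣≤width (window-before i<n s x<i) (window-before i<n t x<i))
    (≤-trans (≤-reflexive (m+n∸n≡m 1 m)) (s≤s z≤n))
  ... | inj₂ refl = ∣-∣≤width (window-valley i<n s refl) (window-valley i<n t refl)

isMaxDist-lowerHalf : ∀ {n i} → 2 ≤ i → i + i ≤ n → IsMaxDist n i (n ∸ i)
isMaxDist-lowerHalf {n} {i@(suc a)} (s≤s 0<a) i+i≤n =
  isMaxDist-witnessed bound (<-trans z<s i<n) attained (m<n⇒0<n∸m i<n)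
  where
  i<n : i < n
  i<n = <-≤-trans (m<m+n i z<s) i+i≤n
  open Witnesses a i<n
  attained : ∣ rotation i (n ∸ i) 0 - adjacentSwap a 0 ∣ ≡ n ∸ i
  attained = trans (cong₂ ∣_-_∣ (rotation-< i (n ∸ i) z<s) (adjacentSwap-other a (<⇒≢ 0<a) λ ()))
                   (∣-∣-identityʳ (n ∸ i))
  bound : DistanceBound n i (n ∸ i)
  bound s t x<n = ≤-trans (distanceBound-⊔ i<n s t x<n) (⊔-lub ≤-refl (m+n≤o⇒m≤o∸n i i+i≤n))

isMaxDist-upperHalf : ∀ {n i} → 1 ≤ i → n ≤ i + i → 2 + i ≤ n → IsMaxDist n i i
isMaxDist-upperHalf {i = i@(suc a)} _ n≤i+i (s≤s {n = m} i<m) =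
  isMaxDist-witnessed bound ≤-refl attained z<s
  where
  i<n : i < suc m
  i<n = m<n⇒m<1+n i<m
  open Witnesses a i<n
  attained : ∣ rotation i (suc m ∸ i) m - adjacentSwap a m ∣ ≡ i
  attained = begin
    ∣ rotation i (suc m ∸ i) m - adjacentSwap a m ∣
      ≡⟨ cong₂ ∣_-_∣ (rotation-≥ i (suc m ∸ i) (<⇒≤ i<m))
                     (adjacentSwap-other a (>⇒≢ (<-trans (n<1+n a) i<m)) (>⇒≢ i<m)) ⟩
    ∣ m ∸ i - m ∣   ≡⟨ m≤n⇒∣m-n∣≡n∸m (m∸n≤m m i) ⟩
    m ∸ (m ∸ i)     ≡⟨ m∸[m∸n]≡n (<⇒≤ i<m) ⟩
    i               ∎
    where open ≡-Reasoning
  bound : DistanceBound (suc m) i i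
  bound s t x<n = ≤-trans (distanceBound-⊔ i<n s t x<n) (⊔-lub (m≤n+o⇒m∸n≤o (suc m) i n≤i+i) ≤-refl)

theorem4p2 : (n : ℕ) → 6 ≤ n → (i : ℕ) → 1 ≤ i → i ≤ n ∸ 1 →
    ((i ≡ 1 ⊎ i ≡ n ∸ 1) → IsMaxDist n i (n ∸ 2))
    × ((2 ≤ i → i ≤ ⌊ n /2⌋ → IsMaxDist n i (n ∸ i))
    × (⌈ n /2⌉ ≤ i → i ≤ n ∸ 2 → IsMaxDist n i i))
theorem4p2 n 6≤n i 1≤i _ = extremes , lowerHalf , upperHalf
  where
  3≤n : 3 ≤ n
  3≤n = ≤-trans (s≤s (s≤s (s≤s z≤n))) 6≤n
  extremes : (i ≡ 1 ⊎ i ≡ n ∸ 1) → IsMaxDist n i (n ∸ 2)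
  extremes (inj₁ refl) = isMaxDist-first 3≤n
  extremes (inj₂ refl) = isMaxDist-last 3≤n
  lowerHalf : 2 ≤ i → i ≤ ⌊ n /2⌋ → IsMaxDist n i (n ∸ i)
  lowerHalf 2≤i i≤⌊n/2⌋ = isMaxDist-lowerHalf 2≤i (m≤⌊n/2⌋⇒m+m≤n i≤⌊n/2⌋)
  upperHalf : ⌈ n /2⌉ ≤ i → i ≤ n ∸ 2 → IsMaxDist n i i
  upperHalf ⌈n/2⌉≤i i≤n∸2 = isMaxDist-upperHalf 1≤i (⌈n/2⌉≤m⇒n≤m+m ⌈n/2⌉≤i)
    (subst (_≤ n) (+-comm i 2) (m≤o∸n⇒m+n≤o i (≤-trans (s≤s (s≤s z≤n)) 3≤n) i≤n∸2))
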